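{- If $n\ge 6$ is an even integer, then $\chi(Q_{n}^{[\natural n-4]})\le 26$.
   Context: $Q_n^{[\natural p]}$ is the graph on $\{0,1\}^n$ in which two vertices are adjacent iff they differ in exactly $p$ coordinates. $\chi$ denotes the chromatic number. -}

module Defs where

open import Data.Nat using (ℕ; zero; suc; _+_)
open import Data.Bool using (Bool; true; false)
open import Data.Vec using (Vec; []; _∷_)
open import Data.Fin using (Fin)
open import Relation.Binary.PropositionalEquality using (_≡_; _≢_)

hamming : ∀ {n} → Vec Bool n → Vec Bool n → ℕ
hamming [] [] = 0
hamming (true ∷ xs) (true ∷ ys) = hamming xs ys
hamming (false ∷ xs) (false ∷ ys) = hamming xs ys
hamming (true ∷ xs) (false ∷ ys) = suc (hamming xs ys)
hamming (false ∷ xs) (true ∷ ys) = suc (hamming xs ys)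

Adj : (n p : ℕ) → Vec Bool n → Vec Bool n → Set
Adj n p x y = hamming x y ≡ p

ProperColouring : (n p k : ℕ) → (Vec Bool n → Fin k) → Set
ProperColouring n p k c = ∀ x y → Adj n p x y → c x ≢ c y

record ChromaticAtMost (n p k : ℕ) : Set where
  constructor colouring
  field
    col    : Vec Bool n → Fin k
    proper : ProperColouring n p k col

-- Colour a word by the Hamming codeword (length 7, covering radius 1) nearest to its first
-- seven bits.  Two words of length n with the same colour then differ in at most 2 of the
-- first seven coordinates and at most n − 7 of the others, so they are never n − 4 apart;
-- this needs n ≥ 8 and uses 16 colours.  For n = 6 the graph is Q₆^{[♮2]}, and colouring
-- x by Σᵢ i·xᵢ mod 13 is proper: flipping the distinct coordinates i, j changes the sum by
-- ±i ± j, which is nonzero with absolute value at most 11.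
module Submission where

open import Defs
open import Data.Nat as ℕ using (ℕ; zero; suc; _≤_; _<_; _+_; _*_; _∸_; _^_; _≤?_; s≤s; z≤n)
open import Data.Nat.Properties
  using (≤-refl; ≤-trans; ≤-reflexive; n≤1+n; m≤n⇒m≤1+n; +-suc; +-mono-≤; +-monoʳ-≤;
         <⇒≱; *-distribˡ-+; m≤m+n; module ≤-Reasoning)
open import Data.Nat.DivMod using (_mod_)
open import Data.Bool using (Bool; true; false; _xor_)
open import Data.Fin using (Fin; inject≤)
open import Data.Fin.Properties using (any?; inject≤-injective)
import Data.Fin.Properties as Fin
open import Data.Vec using (Vec; []; _∷_; _++_; map; lookup; take; drop)
open import Data.Vec.Properties using (take++drop≡id)
open import Data.Product using (∃-syntax; _,_; proj₁; proj₂)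
open import Function using (_∘_)
open import Relation.Nullary using (Dec)
open import Relation.Nullary.Decidable using (map′; _×-dec_; _→-dec_; ¬?; toWitness)
open import Relation.Unary using (Decidable)
open import Relation.Binary.PropositionalEquality

hamming-sym : ∀ {n} (x y : Vec Bool n) → hamming x y ≡ hamming y x
hamming-sym [] [] = refl
hamming-sym (true ∷ x) (true ∷ y) = hamming-sym x y
hamming-sym (true ∷ x) (false ∷ y) = cong suc (hamming-sym x y)
hamming-sym (false ∷ x) (true ∷ y) = cong suc (hamming-sym x y)
hamming-sym (false ∷ x) (false ∷ y) = hamming-sym x y

hamming-triangle : ∀ {n} (x y z : Vec Bool n) → hamming x z ≤ hamming x y + hamming y z
hamming-triangle [] [] [] = z≤n
hamming-triangle (true ∷ x) (true ∷ y) (true ∷ z) = hamming-triangle x y z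
hamming-triangle (false ∷ x) (false ∷ y) (false ∷ z) = hamming-triangle x y z
hamming-triangle (true ∷ x) (false ∷ y) (false ∷ z) = s≤s (hamming-triangle x y z)
hamming-triangle (false ∷ x) (true ∷ y) (true ∷ z) = s≤s (hamming-triangle x y z)
hamming-triangle (true ∷ x) (true ∷ y) (false ∷ z) =
  ≤-trans (s≤s (hamming-triangle x y z)) (≤-reflexive (sym (+-suc _ _)))
hamming-triangle (false ∷ x) (false ∷ y) (true ∷ z) =
  ≤-trans (s≤s (hamming-triangle x y z)) (≤-reflexive (sym (+-suc _ _)))
hamming-triangle (true ∷ x) (false ∷ y) (true ∷ z) =
  ≤-trans (hamming-triangle x y z) (≤-trans (n≤1+n _) (s≤s (+-monoʳ-≤ (hamming x y) (n≤1+n _))))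
hamming-triangle (false ∷ x) (true ∷ y) (false ∷ z) =
  ≤-trans (hamming-triangle x y z) (≤-trans (n≤1+n _) (s≤s (+-monoʳ-≤ (hamming x y) (n≤1+n _))))

hamming-++ : ∀ {m n} (x x′ : Vec Bool m) (y y′ : Vec Bool n) →
             hamming (x ++ y) (x′ ++ y′) ≡ hamming x x′ + hamming y y′
hamming-++ [] [] y y′ = refl
hamming-++ (true ∷ x) (true ∷ x′) y y′ = hamming-++ x x′ y y′
hamming-++ (true ∷ x) (false ∷ x′) y y′ = cong suc (hamming-++ x x′ y y′)
hamming-++ (false ∷ x) (true ∷ x′) y y′ = cong suc (hamming-++ x x′ y y′)
hamming-++ (false ∷ x) (false ∷ x′) y y′ = hamming-++ x x′ y y′

hamming≤length : ∀ {n} (x y : Vec Bool n) → hamming x y ≤ n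
hamming≤length [] [] = z≤n
hamming≤length (true ∷ x) (true ∷ y) = m≤n⇒m≤1+n (hamming≤length x y)
hamming≤length (true ∷ x) (false ∷ y) = s≤s (hamming≤length x y)
hamming≤length (false ∷ x) (true ∷ y) = s≤s (hamming≤length x y)
hamming≤length (false ∷ x) (false ∷ y) = m≤n⇒m≤1+n (hamming≤length x y)

hamming-take-drop : ∀ m {n} (x y : Vec Bool (m + n)) →
                    hamming x y ≡ hamming (take m x) (take m y) + hamming (drop m x) (drop m y)
hamming-take-drop m x y = begin
  hamming x y
    ≡⟨ sym (cong₂ hamming (take++drop≡id m x) (take++drop≡id m y)) ⟩
  hamming (take m x ++ drop m x) (take m y ++ drop m y)
    ≡⟨ hamming-++ (take m x) (take m y) (drop m x) (drop m y) ⟩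
  hamming (take m x) (take m y) + hamming (drop m x) (drop m y) ∎
  where open ≡-Reasoning

all-words? : ∀ n {P : Vec Bool n → Set} → Decidable P → Dec (∀ x → P x)
all-words? zero P? = map′ (λ { p [] → p }) (λ f → f []) (P? [])
all-words? (suc n) P? =
  map′ (λ { (t , f) (true ∷ x) → t x ; (t , f) (false ∷ x) → f x })
       (λ g → g ∘ (true ∷_) , g ∘ (false ∷_))
       (all-words? n (P? ∘ (true ∷_)) ×-dec all-words? n (P? ∘ (false ∷_)))

properColouring? : ∀ n p k (c : Vec Bool n → Fin k) → Dec (ProperColouring n p k c)
properColouring? n p k c =
  all-words? n λ x → all-words? n λ y → (hamming x y ℕ.≟ p) →-dec ¬? (c x Fin.≟ c y)

ChromaticAtMost-mono : ∀ {n p k l} → k ≤ l → ChromaticAtMost n p k → ChromaticAtMost n p l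
ChromaticAtMost-mono k≤l (colouring c proper) =
  colouring (λ x → inject≤ (c x) k≤l)
            λ x y adj eq → proper x y adj (inject≤-injective k≤l k≤l (c x) (c y) eq)

ClassDiameter≤ : ∀ {n k} → (Vec Bool n → Fin k) → ℕ → Set
ClassDiameter≤ c d = ∀ x y → c x ≡ c y → hamming x y ≤ d

classDiameter<⇒proper : ∀ {n p k d} (c : Vec Bool n → Fin k) →
                        ClassDiameter≤ c d → d < p → ProperColouring n p k c
classDiameter<⇒proper c diam d<p x y adj eq = <⇒≱ d<p (subst (_≤ _) adj (diam x y eq))

classDiameter-take : ∀ m {n k d} (c : Vec Bool m → Fin k) →
                     ClassDiameter≤ c d → ClassDiameter≤ (c ∘ take m) (d + n)
classDiameter-take m {n} c diam x y eq = begin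
  hamming x y
    ≡⟨ hamming-take-drop m x y ⟩
  hamming (take m x) (take m y) + hamming (drop m x) (drop m y)
    ≤⟨ +-mono-≤ (diam (take m x) (take m y) eq) (hamming≤length (drop m x) (drop m y)) ⟩
  _ + n ∎
  where open ≤-Reasoning

CoveringRadius≤ : ∀ {m k} → (Fin k → Vec Bool m) → ℕ → Set
CoveringRadius≤ centre ρ = ∀ x → ∃[ i ] hamming x (centre i) ≤ ρ

nearestCentre : ∀ {m k ρ} (centre : Fin k → Vec Bool m) → CoveringRadius≤ centre ρ →
                Vec Bool m → Fin k
nearestCentre centre covering x = proj₁ (covering x)

nearestCentre-classDiameter : ∀ {m k ρ} (centre : Fin k → Vec Bool m)
                              (covering : CoveringRadius≤ centre ρ) →
                              ClassDiameter≤ (nearestCentre centre covering) (ρ + ρ)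
nearestCentre-classDiameter {ρ = ρ} centre covering x y eq = begin
  hamming x y                 ≤⟨ hamming-triangle x z y ⟩
  hamming x z + hamming z y   ≡⟨ cong (hamming x z +_) (hamming-sym z y) ⟩
  hamming x z + hamming y z   ≤⟨ +-mono-≤ (proj₂ (covering x)) y-near-z ⟩
  ρ + ρ                       ∎
  where
  open ≤-Reasoning
  z = centre (nearestCentre centre covering x)
  y-near-z : hamming y z ≤ ρ
  y-near-z = subst (λ i → hamming y (centre i) ≤ ρ) (sym eq) (proj₂ (covering y))

coveringCode⇒chromatic : ∀ {m k ρ} (centre : Fin k → Vec Bool m) → CoveringRadius≤ centre ρ →
                         ∀ r → ChromaticAtMost (m + r) (suc (ρ + ρ + r)) k
coveringCode⇒chromatic {m} centre covering r =
  colouring c (classDiameter<⇒proper c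
                 (classDiameter-take m (nearestCentre centre covering)
                                       (nearestCentre-classDiameter centre covering))
                 ≤-refl)
  where c = nearestCentre centre covering ∘ take m

allWords : ∀ n → Vec (Vec Bool n) (2 ^ n)
allWords zero = [] ∷ []
allWords (suc n) = map (true ∷_) (allWords n) ++ map (false ∷_) (allWords n) ++ []

hammingEncode : Vec Bool 4 → Vec Bool 7
hammingEncode (d₁ ∷ d₂ ∷ d₃ ∷ d₄ ∷ []) =
  (d₁ xor d₂ xor d₄) ∷ (d₁ xor d₃ xor d₄) ∷ d₁ ∷ (d₂ xor d₃ xor d₄) ∷ d₂ ∷ d₃ ∷ d₄ ∷ []

hammingCodeword : Fin 16 → Vec Bool 7
hammingCodeword = lookup (map hammingEncode (allWords 4))

hammingCode-coveringRadius : CoveringRadius≤ hammingCodeword 1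
hammingCode-coveringRadius =
  toWitness {a? = all-words? 7 λ x → any? λ i → hamming x (hammingCodeword i) ≤? 1} _

chromatic-7+r-3+r : ∀ r → ChromaticAtMost (7 + r) (3 + r) 16
chromatic-7+r-3+r = coveringCode⇒chromatic hammingCodeword hammingCode-coveringRadius

weightedSum : ∀ {n} → Vec Bool n → ℕ
weightedSum [] = 0
weightedSum {suc n} (true ∷ x) = suc n + weightedSum x
weightedSum (false ∷ x) = weightedSum x

chromatic-6-2 : ChromaticAtMost 6 2 13
chromatic-6-2 = colouring c (toWitness {a? = properColouring? 6 2 13 c} _)
  where
  c : Vec Bool 6 → Fin 13
  c x = weightedSum x mod 13

corollary4p20 : (m : ℕ) → 6 ≤ 2 * m → ChromaticAtMost (2 * m) (2 * m ∸ 4) 26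
corollary4p20 0 ()
corollary4p20 1 (s≤s (s≤s ()))
corollary4p20 2 (s≤s (s≤s (s≤s (s≤s ()))))
corollary4p20 3 _ = ChromaticAtMost-mono (m≤m+n 13 13) chromatic-6-2
corollary4p20 (suc (suc (suc (suc k)))) _ =
  subst₂ (λ n p → ChromaticAtMost n p 26) (sym 2m≡8+2k) (sym (cong (_∸ 4) 2m≡8+2k))
         (ChromaticAtMost-mono (m≤m+n 16 10) (chromatic-7+r-3+r (suc (2 * k))))
  where
  2m≡8+2k : 2 * (4 + k) ≡ 8 + 2 * k
  2m≡8+2k = *-distribˡ-+ 2 4 k
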